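{- Let $n\ge s\ge 0$ and $k\ge 2$ be integers. If $s\notin\left(\frac{k}{3k-1}n,\frac{k-1}{3k-4}n\right)$, then $\mathrm{ex}(n,s)\le g_k(n,s)$, and equality can only hold if $s\in\left\{\frac{k}{3k-1}n,\frac{k-1}{3k-4}n\right\}$.
   Context: $\mathrm{ex}(n,s)$ is the maximum number of edges in a triangle-free graph on $n$ vertices with independence number at most $s$, and $g_k(n,s)=\frac12 k(k-1)n^2-k(3k-4)ns+\frac12(3k-4)(3k-1)s^2$. -}

module Defs where

open import Data.Nat using (ℕ; _+_; _*_; _∸_; _<ᵇ_)
open import Data.Bool using (Bool; true; false; _∧_; if_then_else_)
open import Data.Fin using (Fin; toℕ)
open import Data.Fin.Subset using (Subset; _∈_; ∣_∣)
open import Data.List using (List; map; allFin)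
open import Data.Nat.ListAction using (sum)
open import Data.Integer as ℤ using (ℤ; +_)
open import Data.Product using (Σ; _×_)
open import Data.Empty using (⊥)
open import Relation.Binary.PropositionalEquality using (_≡_)
import Data.Nat as ℕ

record Graph (n : ℕ) : Set where
  field
    adj    : Fin n → Fin n → Bool
    sym    : ∀ i j → adj i j ≡ adj j i
    irrefl : ∀ i → adj i i ≡ false
open Graph public

edgeCount : ∀ {n} → Graph n → ℕ
edgeCount {n} G =
  sum (map (λ i → sum (map (λ j →
         if (toℕ i <ᵇ toℕ j) ∧ adj G i j then 1 else 0) (allFin n))) (allFin n))

TriangleFree : ∀ {n} → Graph n → Set
TriangleFree {n} G = ∀ (i j k : Fin n) →
  adj G i j ≡ true → adj G j k ≡ true → adj G i k ≡ true → ⊥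

IndependentSet : ∀ {n} → Graph n → Subset n → Set
IndependentSet {n} G S = ∀ (i j : Fin n) → i ∈ S → j ∈ S → adj G i j ≡ false

IndepNumAtMost : ∀ {n} → Graph n → ℕ → Set
IndepNumAtMost {n} G s = ∀ (S : Subset n) → IndependentSet G S → ∣ S ∣ ℕ.≤ s

Admissible : (n s : ℕ) → Graph n → Set
Admissible n s G = TriangleFree G × IndepNumAtMost G s

IsEx : (n s m : ℕ) → Set
IsEx n s m = Σ (Graph n) (λ G → Admissible n s G × edgeCount G ≡ m)
           × (∀ (G : Graph n) → Admissible n s G → edgeCount G ℕ.≤ m)

-- twice g_k(n,s):  2 g_k(n,s) = k(k-1)n² - 2k(3k-4)ns + (3k-4)(3k-1)s²   (an integer)
twiceG : (k n s : ℕ) → ℤ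
twiceG k n s =
    + (k * (k ∸ 1) * n * n)
  ℤ.- + (2 * k * (3 * k ∸ 4) * n * s)
  ℤ.+ + ((3 * k ∸ 4) * (3 * k ∸ 1) * s * s)

module Submission where

-- In a triangle-free graph the neighbourhood of every vertex is
-- an independent set, so when α(G) ≤ s every degree is at most s and, by the
-- handshake argument, 2e(G) ≤ ns.  Writing P = 3k-1, Q = 3k-4, R = k-1, the
-- coefficients satisfy P·R = k·Q + 1, and this single identity yields
--   2 g_k(n,s) = ns + (sP - kn)(sQ - Rn)                              (split)
-- as well as the implication  sP ≤ kn ⇒ sQ ≤ Rn  (the threshold (k-1)/(3k-4)
-- lies above k/(3k-1)).  Hence outside the open interval both factors have
-- the same sign, the "gap" (sP - kn)(sQ - Rn) is non-negative, and
-- 2e(G) ≤ ns ≤ 2 g_k(n,s).  If ex(n,s) = g_k(n,s), the extremal graph forces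
-- gap ≤ 0, so gap = 0 and one of the factors vanishes.

open import Defs
open import Data.Nat using (ℕ; _≤_; _<_; _*_; _∸_)
open import Data.Integer as ℤ using (+_)
open import Data.Product using (_×_)
open import Data.Sum using (_⊎_)
open import Relation.Nullary using (¬_)
open import Relation.Binary.PropositionalEquality using (_≡_)

open import Data.Nat as ℕ using (zero; suc; _+_; _<ᵇ_; z≤n; NonZero)
import Data.Nat.Properties as ℕP
import Data.Integer.Properties as ℤP
open import Data.Bool using (Bool; true; false; _∧_; if_then_else_; T)
open import Data.Fin using (Fin; toℕ) renaming (zero to fzero; suc to fsuc)
open import Data.Fin.Subset using (Subset; ∣_∣)
open import Data.List using (map; allFin; tabulate)
import Data.List.Properties as ListP
open import Data.Nat.ListAction using (sum)
import Data.Vec as Vec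
import Data.Vec.Properties as VecP
open import Data.Product using (_,_)
open import Data.Sum using (inj₁; inj₂)
open import Data.Empty using (⊥; ⊥-elim)
open import Function using (_∘_)
open import Relation.Nullary using (yes; no)
open import Relation.Binary.PropositionalEquality
  using (refl; trans; cong; cong₂; subst; module ≡-Reasoning)
  renaming (sym to ≡-sym)
open import Algebra.Properties.CommutativeMonoid.Sum ℕP.+-0-commutativeMonoid
  using (sum-cong-≗; ∑-comm; ∑-distrib-+; sum-syntax)
import Data.Nat.Tactic.RingSolver as ℕSolver
import Data.Integer.Tactic.RingSolver as ℤSolver

∑-mono : ∀ n {f g : Fin n → ℕ} → (∀ i → f i ≤ g i) →
         ∑[ i < n ] f i ≤ ∑[ i < n ] g i
∑-mono zero    f≤g = z≤n
∑-mono (suc n) f≤g = ℕP.+-mono-≤ (f≤g fzero) (∑-mono n (f≤g ∘ fsuc))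

∑-bounded : ∀ n s {f : Fin n → ℕ} → (∀ i → f i ≤ s) → ∑[ i < n ] f i ≤ n * s
∑-bounded zero    s f≤s = z≤n
∑-bounded (suc n) s f≤s = ℕP.+-mono-≤ (f≤s fzero) (∑-bounded n s (f≤s ∘ fsuc))

listSum≡∑ : ∀ n (f : Fin n → ℕ) → sum (map f (allFin n)) ≡ ∑[ i < n ] f i
listSum≡∑ zero    f = refl
listSum≡∑ (suc n) f = cong (_+_ (f fzero)) (begin
  sum (map f (tabulate fsuc))      ≡⟨ cong sum (ListP.map-tabulate fsuc f) ⟩
  sum (tabulate (f ∘ fsuc))        ≡⟨ cong sum (≡-sym (ListP.map-tabulate (λ i → i) (f ∘ fsuc))) ⟩
  sum (map (f ∘ fsuc) (allFin n))  ≡⟨ listSum≡∑ n (f ∘ fsuc) ⟩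
  ∑[ i < n ] f (fsuc i)            ∎)
  where
  open ≡-Reasoning

indicator : Bool → ℕ
indicator b = if b then 1 else 0

∣tabulate∣≡∑ : ∀ n (b : Fin n → Bool) → ∣ Vec.tabulate b ∣ ≡ ∑[ i < n ] indicator (b i)
∣tabulate∣≡∑ zero    b = refl
∣tabulate∣≡∑ (suc n) b with b fzero
... | true  = cong suc (∣tabulate∣≡∑ n (b ∘ fsuc))
... | false = ∣tabulate∣≡∑ n (b ∘ fsuc)

indicator-split : ∀ b c a → (T b → T c → ⊥) →
                  indicator (b ∧ a) + indicator (c ∧ a) ≤ indicator a
indicator-split true  true  a excl = ⊥-elim (excl _ _)
indicator-split true  false a excl = ℕP.≤-reflexive (ℕP.+-identityʳ (indicator a))
indicator-split false true  a excl = ℕP.≤-refl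
indicator-split false false a excl = z≤n

module _ {n : ℕ} (G : Graph n) where

  degree : Fin n → ℕ
  degree i = ∑[ j < n ] indicator (adj G i j)

  neighbourhood : Fin n → Subset n
  neighbourhood i = Vec.tabulate (adj G i)

  forwardEdge : Fin n → Fin n → ℕ
  forwardEdge i j = indicator ((toℕ i <ᵇ toℕ j) ∧ adj G i j)

  edgeCount≡∑ : edgeCount G ≡ ∑[ i < n ] ∑[ j < n ] forwardEdge i j
  edgeCount≡∑ = trans (cong sum (ListP.map-cong (λ i → listSum≡∑ n (forwardEdge i)) (allFin n)))
                      (listSum≡∑ n (λ i → ∑[ j < n ] forwardEdge i j))

  forwardEdge-pair : ∀ i j → forwardEdge i j + forwardEdge j i ≤ indicator (adj G i j)
  forwardEdge-pair i j rewrite Graph.sym G j i =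
    indicator-split (toℕ i <ᵇ toℕ j) (toℕ j <ᵇ toℕ i) (adj G i j)
      (λ i<j j<i → ℕP.<-asym (ℕP.<ᵇ⇒< (toℕ i) (toℕ j) i<j) (ℕP.<ᵇ⇒< (toℕ j) (toℕ i) j<i))

  handshake : 2 * edgeCount G ≤ ∑[ i < n ] degree i
  handshake = subst (_≤ ∑[ i < n ] degree i) (≡-sym double-count)
                (∑-mono n (λ i → ∑-mono n (forwardEdge-pair i)))
    where
    open ≡-Reasoning
    E : ℕ
    E = ∑[ i < n ] ∑[ j < n ] forwardEdge i j
    double-count : 2 * edgeCount G ≡ ∑[ i < n ] ∑[ j < n ] (forwardEdge i j + forwardEdge j i)
    double-count = begin
      2 * edgeCount G                                        ≡⟨ cong (2 *_) edgeCount≡∑ ⟩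
      E + (E + 0)                                            ≡⟨ cong (_+_ E) (ℕP.+-identityʳ E) ⟩
      E + E                                                  ≡⟨ cong (_+_ E) (∑-comm forwardEdge) ⟩
      E + ∑[ i < n ] ∑[ j < n ] forwardEdge j i
        ≡⟨ ≡-sym (∑-distrib-+ {n} (λ i → ∑[ j < n ] forwardEdge i j) (λ i → ∑[ j < n ] forwardEdge j i)) ⟩
      ∑[ i < n ] (∑[ j < n ] forwardEdge i j + ∑[ j < n ] forwardEdge j i)
        ≡⟨ sum-cong-≗ (λ i → ≡-sym (∑-distrib-+ (forwardEdge i) (λ j → forwardEdge j i))) ⟩
      ∑[ i < n ] ∑[ j < n ] (forwardEdge i j + forwardEdge j i) ∎

  neighbourhood-independent : TriangleFree G → ∀ i → IndependentSet G (neighbourhood i)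
  neighbourhood-independent triangleFree i j k j∈N k∈N with adj G j k in jk
  ... | false = refl
  ... | true  = ⊥-elim (triangleFree i j k (adjacent j j∈N) jk (adjacent k k∈N))
    where
    adjacent : ∀ j → Vec._[_]=_ (neighbourhood i) j true → adj G i j ≡ true
    adjacent j j∈N = trans (≡-sym (VecP.lookup∘tabulate (adj G i) j)) (VecP.[]=⇒lookup j∈N)

  degree-bounded : ∀ s → Admissible n s G → ∀ i → degree i ≤ s
  degree-bounded s (triangleFree , α≤s) i =
    subst (_≤ s) (∣tabulate∣≡∑ n (adj G i))
      (α≤s (neighbourhood i) (neighbourhood-independent triangleFree i))

  twice-edges-bounded : ∀ s → Admissible n s G → 2 * edgeCount G ≤ n * s
  twice-edges-bounded s admissible =
    ℕP.≤-trans handshake (∑-bounded n s (degree-bounded s admissible))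

open ℤ using (0ℤ) renaming (_+_ to _+ℤ_; _-_ to _-ℤ_; _*_ to _*ℤ_; _≤_ to _≤ℤ_)

expand-product : ∀ a b c d y w → y +ℤ w ≡ a *ℤ d +ℤ b *ℤ c →
                 b *ℤ d -ℤ y +ℤ a *ℤ c ≡ w +ℤ (a -ℤ b) *ℤ (c -ℤ d)
expand-product a b c d y w cross = begin
  b *ℤ d -ℤ y +ℤ a *ℤ c                                           ≡⟨ regroup a b c d y w ⟩
  w +ℤ (a -ℤ b) *ℤ (c -ℤ d) +ℤ (a *ℤ d +ℤ b *ℤ c -ℤ (y +ℤ w))    ≡⟨ cong (λ t → w +ℤ (a -ℤ b) *ℤ (c -ℤ d) +ℤ (t -ℤ (y +ℤ w))) (≡-sym cross) ⟩
  w +ℤ (a -ℤ b) *ℤ (c -ℤ d) +ℤ (y +ℤ w -ℤ (y +ℤ w))              ≡⟨ cong (_+ℤ_ (w +ℤ (a -ℤ b) *ℤ (c -ℤ d))) (ℤP.+-inverseʳ (y +ℤ w)) ⟩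
  w +ℤ (a -ℤ b) *ℤ (c -ℤ d) +ℤ 0ℤ                                 ≡⟨ ℤP.+-identityʳ _ ⟩
  w +ℤ (a -ℤ b) *ℤ (c -ℤ d)                                       ∎
  where
  open ≡-Reasoning
  regroup : ∀ a b c d y w → b *ℤ d -ℤ y +ℤ a *ℤ c
          ≡ w +ℤ (a -ℤ b) *ℤ (c -ℤ d) +ℤ (a *ℤ d +ℤ b *ℤ c -ℤ (y +ℤ w))
  regroup = ℤSolver.solve-∀

difference-zero : ∀ {a b} → + a -ℤ + b ≡ 0ℤ → a ≡ b
difference-zero {a} {b} = ℤP.+-injective ∘ ℤP.i-j≡0⇒i≡j (+ a) (+ b)

same-sign-product : ∀ x y → (0ℤ ≤ℤ x × 0ℤ ≤ℤ y) ⊎ (x ≤ℤ 0ℤ × y ≤ℤ 0ℤ) → 0ℤ ≤ℤ x *ℤ y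
same-sign-product x y (inj₁ (0≤x , 0≤y)) = ℤP.*-monoʳ-≤-nonNeg y {{ℤ.nonNegative 0≤y}} 0≤x
same-sign-product x y (inj₂ (x≤0 , y≤0)) =
  subst (_≤ℤ x *ℤ y) (ℤP.*-zeroʳ x) (ℤP.*-monoˡ-≤-nonPos x {{ℤ.nonPositive x≤0}} y≤0)

excess-nonpositive : ∀ a g x → x ≡ a +ℤ g → x ≤ℤ a → g ≤ℤ 0ℤ
excess-nonpositive a g x x≡a+g x≤a = subst (_≤ℤ 0ℤ) g≡x-a (ℤP.i≤j⇒i-j≤0 x≤a)
  where
  cancel : ∀ a g → a +ℤ g -ℤ a ≡ g
  cancel = ℤSolver.solve-∀
  g≡x-a : x -ℤ a ≡ g
  g≡x-a = trans (cong (_-ℤ a) x≡a+g) (cancel a g)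

module Thresholds (k P Q R : ℕ) (coefficients : P * R ≡ k * Q + 1) where

  lowerFactor upperFactor gap : ℕ → ℕ → ℤ.ℤ
  lowerFactor n s = + (s * P) -ℤ + (k * n)
  upperFactor n s = + (s * Q) -ℤ + (R * n)
  gap n s = lowerFactor n s *ℤ upperFactor n s

  split : ∀ n s → + (k * R * n * n) -ℤ + (2 * k * Q * n * s) +ℤ + (Q * P * s * s)
                ≡ + (n * s) +ℤ gap n s
  split n s = begin
    + (k * R * n * n) -ℤ + (2 * k * Q * n * s) +ℤ + (Q * P * s * s)
      ≡⟨ cong₂ (λ x z → x -ℤ + (2 * k * Q * n * s) +ℤ z)
               (cast (k * R * n * n) (k * n) (R * n) (reorder₁ k R n))
               (cast (Q * P * s * s) (s * P) (s * Q) (reorder₂ Q P s)) ⟩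
    + (k * n) *ℤ + (R * n) -ℤ + (2 * k * Q * n * s) +ℤ + (s * P) *ℤ + (s * Q)
      ≡⟨ expand-product (+ (s * P)) (+ (k * n)) (+ (s * Q)) (+ (R * n)) _ (+ (n * s)) cross ⟩
    + (n * s) +ℤ gap n s ∎
    where
    open ≡-Reasoning
    cast : ∀ x a b → x ≡ a * b → + x ≡ + a *ℤ + b
    cast x a b x≡ab = trans (cong +_ x≡ab) (ℤP.pos-* a b)
    reorder₁ : ∀ k R n → k * R * n * n ≡ k * n * (R * n)
    reorder₁ = ℕSolver.solve-∀
    reorder₂ : ∀ Q P s → Q * P * s * s ≡ s * P * (s * Q)
    reorder₂ = ℕSolver.solve-∀
    crossℕ : 2 * k * Q * n * s + n * s ≡ s * P * (R * n) + k * n * (s * Q)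
    crossℕ = begin
      2 * k * Q * n * s + n * s        ≡⟨ collect k Q n s ⟩
      (k * Q + 1 + k * Q) * (n * s)    ≡⟨ cong (λ t → (t + k * Q) * (n * s)) (≡-sym coefficients) ⟩
      (P * R + k * Q) * (n * s)        ≡⟨ distribute P R k Q n s ⟩
      s * P * (R * n) + k * n * (s * Q) ∎
      where
      collect : ∀ k Q n s → 2 * k * Q * n * s + n * s ≡ (k * Q + 1 + k * Q) * (n * s)
      collect = ℕSolver.solve-∀
      distribute : ∀ P R k Q n s → (P * R + k * Q) * (n * s) ≡ s * P * (R * n) + k * n * (s * Q)
      distribute = ℕSolver.solve-∀
    cross : + (2 * k * Q * n * s) +ℤ + (n * s) ≡ + (s * P) *ℤ + (R * n) +ℤ + (k * n) *ℤ + (s * Q)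
    cross = begin
      + (2 * k * Q * n * s) +ℤ + (n * s)            ≡⟨ ≡-sym (ℤP.pos-+ (2 * k * Q * n * s) (n * s)) ⟩
      + (2 * k * Q * n * s + n * s)                 ≡⟨ cong +_ crossℕ ⟩
      + (s * P * (R * n) + k * n * (s * Q))         ≡⟨ ℤP.pos-+ (s * P * (R * n)) (k * n * (s * Q)) ⟩
      + (s * P * (R * n)) +ℤ + (k * n * (s * Q))    ≡⟨ cong₂ _+ℤ_ (ℤP.pos-* (s * P) (R * n)) (ℤP.pos-* (k * n) (s * Q)) ⟩
      + (s * P) *ℤ + (R * n) +ℤ + (k * n) *ℤ + (s * Q) ∎

  below-lower⇒below-upper : ∀ .{{_ : NonZero k}} n s → s * P ≤ k * n → s * Q ≤ R * n
  below-lower⇒below-upper n s sP≤kn = ℕP.*-cancelˡ-≤ k (begin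
    k * (s * Q)        ≤⟨ ℕP.m≤m+n (k * (s * Q)) s ⟩
    k * (s * Q) + s    ≡⟨ scale k Q s ⟩
    s * (k * Q + 1)    ≡⟨ cong (s *_) (≡-sym coefficients) ⟩
    s * (P * R)        ≡⟨ swap s P R ⟩
    R * (s * P)        ≤⟨ ℕP.*-monoʳ-≤ R sP≤kn ⟩
    R * (k * n)        ≡⟨ exchange R k n ⟩
    k * (R * n)        ∎)
    where
    open ℕP.≤-Reasoning
    scale : ∀ k Q s → k * (s * Q) + s ≡ s * (k * Q + 1)
    scale = ℕSolver.solve-∀
    swap : ∀ a b c → a * (b * c) ≡ c * (a * b)
    swap = ℕSolver.solve-∀
    exchange : ∀ a b c → a * (b * c) ≡ b * (a * c)
    exchange = ℕSolver.solve-∀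

  gap-nonnegative : ∀ .{{_ : NonZero k}} n s →
                    ¬ ((k * n < s * P) × (s * Q < R * n)) → 0ℤ ≤ℤ gap n s
  gap-nonnegative n s outside with k * n ℕ.<? s * P
  ... | yes kn<sP = same-sign-product _ _ (inj₁
        ( ℤP.i≤j⇒0≤j-i (ℤ.+≤+ (ℕP.<⇒≤ kn<sP))
        , ℤP.i≤j⇒0≤j-i (ℤ.+≤+ (ℕP.≮⇒≥ (λ sQ<Rn → outside (kn<sP , sQ<Rn))))))
  ... | no  kn≮sP = same-sign-product _ _ (inj₂
        ( ℤP.i≤j⇒i-j≤0 (ℤ.+≤+ sP≤kn)
        , ℤP.i≤j⇒i-j≤0 (ℤ.+≤+ (below-lower⇒below-upper n s sP≤kn))))
    where
    sP≤kn : s * P ≤ k * n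
    sP≤kn = ℕP.≮⇒≥ kn≮sP

  gap-zero : ∀ n s → gap n s ≡ 0ℤ → s * P ≡ k * n ⊎ s * Q ≡ R * n
  gap-zero n s gap≡0 with ℤP.i*j≡0⇒i≡0∨j≡0 (lowerFactor n s) gap≡0
  ... | inj₁ lower≡0 = inj₁ (difference-zero lower≡0)
  ... | inj₂ upper≡0 = inj₂ (difference-zero upper≡0)

g-coefficients : ∀ k → 2 ≤ k → (3 * k ∸ 1) * (k ∸ 1) ≡ k * (3 * k ∸ 4) + 1
g-coefficients (suc zero) (ℕ.s≤s ())
g-coefficients (suc (suc t)) _ = begin
  (3 * (2 + t) ∸ 1) * (1 + t)      ≡⟨ cong (λ x → (x ∸ 1) * (1 + t)) (triple t) ⟩
  (5 + 3 * t) * (1 + t)            ≡⟨ identity t ⟩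
  (2 + t) * (2 + 3 * t) + 1        ≡⟨ cong (λ x → (2 + t) * (x ∸ 4) + 1) (≡-sym (triple t)) ⟩
  (2 + t) * (3 * (2 + t) ∸ 4) + 1  ∎
  where
  open ≡-Reasoning
  triple : ∀ t → 3 * (2 + t) ≡ 6 + 3 * t
  triple = ℕSolver.solve-∀
  identity : ∀ t → (5 + 3 * t) * (1 + t) ≡ (2 + t) * (2 + 3 * t) + 1
  identity = ℕSolver.solve-∀

fact2p6 : (n s k : ℕ) → s ≤ n → 2 ≤ k →
    ¬ ((k * n < s * (3 * k ∸ 1)) × (s * (3 * k ∸ 4) < (k ∸ 1) * n)) →
    ((G : Graph n) → Admissible n s G → (+ (2 * edgeCount G)) ℤ.≤ twiceG k n s)
    × ((m : ℕ) → IsEx n s m → + (2 * m) ≡ twiceG k n s →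
        (s * (3 * k ∸ 1) ≡ k * n) ⊎ (s * (3 * k ∸ 4) ≡ (k ∸ 1) * n))
fact2p6 n s k _ k≥2 outside = upper-bound , equality-case
  where
  open Thresholds k (3 * k ∸ 1) (3 * k ∸ 4) (k ∸ 1) (g-coefficients k k≥2)
  instance
    k≢0 : NonZero k
    k≢0 = ℕ.>-nonZero (ℕP.≤-trans (ℕP.n≤1+n 1) k≥2)
  gap≥0 : 0ℤ ≤ℤ gap n s
  gap≥0 = gap-nonnegative n s outside
  upper-bound : (G : Graph n) → Admissible n s G → + (2 * edgeCount G) ≤ℤ twiceG k n s
  upper-bound G admissible = subst (+ (2 * edgeCount G) ≤ℤ_) (≡-sym (split n s))
    (ℤP.≤-trans (ℤ.+≤+ (twice-edges-bounded G s admissible))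
                (ℤP.i≤i+j (+ (n * s)) (gap n s) {{ℤ.nonNegative gap≥0}}))
  equality-case : (m : ℕ) → IsEx n s m → + (2 * m) ≡ twiceG k n s →
                  (s * (3 * k ∸ 1) ≡ k * n) ⊎ (s * (3 * k ∸ 4) ≡ (k ∸ 1) * n)
  equality-case m ((G , admissible , refl) , _) 2m≡2g = gap-zero n s (ℤP.≤-antisym gap≤0 gap≥0)
    where
    gap≤0 : gap n s ≤ℤ 0ℤ
    gap≤0 = excess-nonpositive (+ (n * s)) (gap n s) (+ (2 * m)) (trans 2m≡2g (split n s))
              (ℤ.+≤+ (twice-edges-bounded G s admissible))
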